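{- If $\pi$ is a normal form proof of $\vdash \phi$ in $\mathsf{LNGL}$, then $\pi$ can be transformed into a proof of $\vdash \phi$ in $\mathsf{GL_{seq}}$.
   Context: Formulae are built from atoms by $\neg,\lor,\Box$. A linear nested sequent is $\Gamma_{1} \vdash \Delta_{1} \mathbin{/\!/} \cdots \mathbin{/\!/} \Gamma_{n} \vdash \Delta_{n}$ with formula multisets $\Gamma_i,\Delta_i$. The calculus $\mathsf{LNGL}$ has rules ($\mathcal{G}$ a possibly empty prefix): $\mathsf{id_1}$: $\mathcal{G} \mathbin{/\!/} \Gamma, p \vdash p, \Delta$; $\mathsf{id_2}$: $\mathcal{G} \mathbin{/\!/} \Gamma, \Box\phi \vdash \Box\phi, \Delta$; local rules $\lor\mathsf{L}$: from $\mathcal{G} \mathbin{/\!/} \Gamma, \phi \vdash \Delta$ and $\mathcal{G} \mathbin{/\!/} \Gamma, \psi \vdash \Delta$ infer $\mathcal{G} \mathbin{/\!/} \Gamma, \phi\lor\psi \vdash \Delta$; $\lor\mathsf{R}$: from $\mathcal{G} \mathbin{/\!/} \Gamma \vdash \phi,\psi,\Delta$ infer $\mathcal{G} \mathbin{/\!/} \Gamma \vdash \phi\lor\psi,\Delta$; $\neg\mathsf{L}$: from $\mathcal{G} \mathbin{/\!/} \Gamma \vdash \phi,\Delta$ infer $\mathcal{G} \mathbin{/\!/} \Gamma,\neg\phi \vdash \Delta$; $\neg\mathsf{R}$: from $\mathcal{G} \mathbin{/\!/} \Gamma,\phi \vdash \Delta$ infer $\mathcal{G} \mathbin{/\!/}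 \Gamma \vdash \neg\phi,\Delta$; $\mathsf{4L}$: from $\mathcal{G} \mathbin{/\!/} \Gamma,\Box\phi \vdash \Delta \mathbin{/\!/} \Sigma,\Box\phi \vdash \Pi$ infer $\mathcal{G} \mathbin{/\!/} \Gamma,\Box\phi \vdash \Delta \mathbin{/\!/} \Sigma \vdash \Pi$; $\Box\mathsf{L}$: from $\mathcal{G} \mathbin{/\!/} \Gamma,\Box\phi \vdash \Delta \mathbin{/\!/} \Sigma,\phi \vdash \Pi$ infer $\mathcal{G} \mathbin{/\!/} \Gamma,\Box\phi \vdash \Delta \mathbin{/\!/} \Sigma \vdash \Pi$; $\Box\mathsf{R}$: from $\mathcal{G} \mathbin{/\!/} \Gamma \vdash \Delta \mathbin{/\!/} \Box\phi \vdash \phi$ infer $\mathcal{G} \mathbin{/\!/} \Gamma \vdash \Box\phi,\Delta$. An $\mathsf{LNGL}$ proof is in normal form iff, reading bottom-up, each $\Box\mathsf{R}$ application's premise is derived by a block (derivation using only the given rules) of $\mathsf{4L}$ rules, whose premise is derived by a block of $\Box\mathsf{L}$ rules, whose premise is derived by a block of local rules ($\neg\mathsf{L},\neg\mathsf{R},\lor\mathsf{L},\lor\mathsf{R}$). The Gentzen calculus $\mathsf{GL_{seq}}$ (a variant of Sambin and Valentini's calculus) operates on sequents $\Gamma \vdash \Delta$ of formula multisets with rules: $\mathsf{id}$: $\Gamma,\phi \vdash \phi,\Delta$; the standard rules $\neg\mathsf{L}$, $\neg\mathsf{R}$, $\lor\mathsf{L}$, $\lor\mathsf{R}$; and $\Box_{\mathsf{GL}}$: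 from $\Box\Gamma,\Gamma,\Box\phi \vdash \phi$ infer $\Sigma,\Box\Gamma \vdash \Box\phi,\Delta$, where $\Box\Gamma$ prefixes $\Box$ to each formula of $\Gamma$. Weakening is admissible in $\mathsf{GL_{seq}}$. -}

module Defs where

open import Data.Nat using (ℕ)
open import Data.List using (List; []; _∷_; _++_; _∷ʳ_; map; [_])
open import Data.Product using (_×_; _,_)
open import Data.List.Membership.Propositional using (_∈_)
open import Data.List.Relation.Binary.Permutation.Propositional using (_↭_)

data Fm : Set where
  atom : ℕ → Fm
  ¬′_  : Fm → Fm
  _∨′_ : Fm → Fm → Fm
  □_   : Fm → Fm

-- Multisets are represented by lists; every rule is applied up to
-- permutation (principal formulas located via _↭_ / _∈_).
Seq : Set
Seq = List Fm × List Fm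

-- A linear nested sequent  G // Γ ⊢ Δ : a (possibly empty) prefix G of
-- components followed by the last (active) component Γ ⊢ Δ.
LNS : Set
LNS = List Seq × Seq

data LN : LNS → Set where
  id₁ : ∀ {G Γ Δ} (p : ℕ) → atom p ∈ Γ → atom p ∈ Δ → LN (G , Γ , Δ)
  id₂ : ∀ {G Γ Δ} (φ : Fm) → □ φ ∈ Γ → □ φ ∈ Δ → LN (G , Γ , Δ)
  ∨L  : ∀ {G Γ Γ′ Δ} (φ ψ : Fm) → Γ ↭ ((φ ∨′ ψ) ∷ Γ′) →
        LN (G , φ ∷ Γ′ , Δ) → LN (G , ψ ∷ Γ′ , Δ) → LN (G , Γ , Δ)
  ∨R  : ∀ {G Γ Δ Δ′} (φ ψ : Fm) → Δ ↭ ((φ ∨′ ψ) ∷ Δ′) →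
        LN (G , Γ , φ ∷ ψ ∷ Δ′) → LN (G , Γ , Δ)
  ¬L  : ∀ {G Γ Γ′ Δ} (φ : Fm) → Γ ↭ ((¬′ φ) ∷ Γ′) →
        LN (G , Γ′ , φ ∷ Δ) → LN (G , Γ , Δ)
  ¬R  : ∀ {G Γ Δ Δ′} (φ : Fm) → Δ ↭ ((¬′ φ) ∷ Δ′) →
        LN (G , φ ∷ Γ , Δ′) → LN (G , Γ , Δ)
  4L  : ∀ {G Γ Δ Σ Π} (φ : Fm) → □ φ ∈ Γ →
        LN (G ∷ʳ (Γ , Δ) , □ φ ∷ Σ , Π) → LN (G ∷ʳ (Γ , Δ) , Σ , Π)
  □L  : ∀ {G Γ Δ Σ Π} (φ : Fm) → □ φ ∈ Γ →
        LN (G ∷ʳ (Γ , Δ) , φ ∷ Σ , Π) → LN (G ∷ʳ (Γ , Δ) , Σ , Π)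
  □R  : ∀ {G Γ Δ Δ′} (φ : Fm) → Δ ↭ (□ φ ∷ Δ′) →
        LN (G ∷ʳ (Γ , Δ′) , [ □ φ ] , [ φ ]) → LN (G , Γ , Δ)

-- Reading bottom-up, every □R premise is derived by a block
-- of 4L rules, whose premise is derived by a block of □L rules, whose
-- premise is derived by a block of local rules; the premises (leaves) of
-- a local block are closed by an initial sequent or by a further □R.

mutual
  data LocalBlock : ∀ {S} → LN S → Set where
    lb-leaf : ∀ {S} {d : LN S} → Leaf d → LocalBlock d
    lb-∨L   : ∀ {G Γ Γ′ Δ φ ψ} {e : Γ ↭ ((φ ∨′ ψ) ∷ Γ′)}
                {d₁ : LN (G , φ ∷ Γ′ , Δ)} {d₂ : LN (G , ψ ∷ Γ′ , Δ)} →
              LocalBlock d₁ → LocalBlock d₂ → LocalBlock (∨L φ ψ e d₁ d₂)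
    lb-∨R   : ∀ {G Γ Δ Δ′ φ ψ} {e : Δ ↭ ((φ ∨′ ψ) ∷ Δ′)}
                {d : LN (G , Γ , φ ∷ ψ ∷ Δ′)} →
              LocalBlock d → LocalBlock (∨R φ ψ e d)
    lb-¬L   : ∀ {G Γ Γ′ Δ φ} {e : Γ ↭ ((¬′ φ) ∷ Γ′)}
                {d : LN (G , Γ′ , φ ∷ Δ)} →
              LocalBlock d → LocalBlock (¬L φ e d)
    lb-¬R   : ∀ {G Γ Δ Δ′ φ} {e : Δ ↭ ((¬′ φ) ∷ Δ′)}
                {d : LN (G , φ ∷ Γ , Δ′)} →
              LocalBlock d → LocalBlock (¬R φ e d)

  data Leaf : ∀ {S} → LN S → Set where
    leaf-id₁ : ∀ {G Γ Δ p} {a : atom p ∈ Γ} {b : atom p ∈ Δ} →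
               Leaf (id₁ {G} p a b)
    leaf-id₂ : ∀ {G Γ Δ φ} {a : □ φ ∈ Γ} {b : □ φ ∈ Δ} →
               Leaf (id₂ {G} φ a b)
    leaf-□R  : ∀ {G Γ Δ Δ′ φ} {e : Δ ↭ (□ φ ∷ Δ′)}
                 {d : LN (G ∷ʳ (Γ , Δ′) , [ □ φ ] , [ φ ])} →
               FourBlock d → Leaf (□R φ e d)

  data FourBlock : ∀ {S} → LN S → Set where
    fb-end : ∀ {S} {d : LN S} → BoxLBlock d → FourBlock d
    fb-4L  : ∀ {G Γ Δ Σ Π φ} {m : □ φ ∈ Γ}
               {d : LN (G ∷ʳ (Γ , Δ) , □ φ ∷ Σ , Π)} →
             FourBlock d → FourBlock (4L φ m d)

  data BoxLBlock : ∀ {S} → LN S → Set where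
    bl-end : ∀ {S} {d : LN S} → LocalBlock d → BoxLBlock d
    bl-□L  : ∀ {G Γ Δ Σ Π φ} {m : □ φ ∈ Γ}
               {d : LN (G ∷ʳ (Γ , Δ) , φ ∷ Σ , Π)} →
             BoxLBlock d → BoxLBlock (□L φ m d)

NormalForm : ∀ {S} → LN S → Set
NormalForm π = LocalBlock π

data GL : Seq → Set where
  id  : ∀ {Γ Δ} (φ : Fm) → φ ∈ Γ → φ ∈ Δ → GL (Γ , Δ)
  ∨L  : ∀ {Γ Γ′ Δ} (φ ψ : Fm) → Γ ↭ ((φ ∨′ ψ) ∷ Γ′) →
        GL (φ ∷ Γ′ , Δ) → GL (ψ ∷ Γ′ , Δ) → GL (Γ , Δ)
  ∨R  : ∀ {Γ Δ Δ′} (φ ψ : Fm) → Δ ↭ ((φ ∨′ ψ) ∷ Δ′) →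
        GL (Γ , φ ∷ ψ ∷ Δ′) → GL (Γ , Δ)
  ¬L  : ∀ {Γ Γ′ Δ} (φ : Fm) → Γ ↭ ((¬′ φ) ∷ Γ′) →
        GL (Γ′ , φ ∷ Δ) → GL (Γ , Δ)
  ¬R  : ∀ {Γ Δ Δ′} (φ : Fm) → Δ ↭ ((¬′ φ) ∷ Δ′) →
        GL (φ ∷ Γ , Δ′) → GL (Γ , Δ)
  □GL : ∀ {Λ Θ Σ Δ} (Γ : List Fm) (φ : Fm) →
        Λ ↭ (map □_ Γ ++ Σ) → Θ ↭ (□ φ ∷ Δ) →
        GL (map □_ Γ ++ Γ ++ [ □ φ ] , [ φ ]) → GL (Λ , Θ)

-- Read bottom-up, a normal-form LNGL proof is a GL_seq proof in disguise: local blocks are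
-- local rules, and a □R leaf together with its 4L- and □L-blocks is a single □GL step whose
-- boxed context consists of all boxed formulas of the current antecedent, because 4L and □L
-- only import □ψ and ψ for boxed formulas □ψ of that antecedent. Imports may repeat, so each
-- LNGL sequent is translated into every sequent containing it as sets, and the surplus is
-- removed by height-preserving contraction. Contraction is proved for a height-bounded copy of
-- GL_seq by induction on the formula and then on the derivation, from height-preserving
-- invertibility of the ¬ and ∨ rules.

{-# OPTIONS --safe #-}
module Submission where

open import Defs
open import Data.List using (List; []; [_]; _∷_; _++_; _∷ʳ_; map)
open import Data.List.Properties using (∷ʳ-injectiveʳ)
open import Data.List.Membership.Propositional using (_∈_)
open import Data.List.Membership.Propositional.Properties
  using (∈-∃++; ∈-++⁻; ∈-map⁻; ∈-map⁺; ∈-++⁺ˡ; ∈-++⁺ʳ)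
open import Data.List.Relation.Unary.Any using (here; there; toSum)
open import Data.List.Relation.Binary.Subset.Propositional {A = Fm} using (_⊆_)
open import Data.List.Relation.Binary.Subset.Propositional.Properties
  using (⊆-refl; ⊆-respˡ-↭; ∷⁺ʳ; ∈-∷⁺ʳ)
open import Data.List.Relation.Binary.Permutation.Propositional
  using (_↭_; ↭-refl; ↭-sym; ↭-trans; prep; swap)
open import Data.List.Relation.Binary.Permutation.Propositional.Properties
  using (∈-resp-↭; drop-∷; shift; shifts; ++⁺ˡ; ++⁺ʳ; ++⁺; map⁺)
open import Data.Nat using (ℕ; suc; _⊔_; _≤_; s≤s)
open import Data.Nat.Properties using (m≤m⊔n; m≤n⊔m; n≤1+n)
open import Data.Product as Product using (_,_; _×_; ∃; proj₁; proj₂; map₂)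
open import Data.Sum using (_⊎_; inj₁; inj₂)
open import Data.Unit using (⊤; tt)
open import Relation.Binary.PropositionalEquality using (_≡_; refl)

module _ {a} {A : Set a} where

  ∈⇒↭∷ : ∀ {x : A} {xs} → x ∈ xs → ∃ λ ys → xs ↭ x ∷ ys
  ∈⇒↭∷ {x} x∈xs with ys , zs , refl ← ∈-∃++ x∈xs = ys ++ zs , shift x ys zs

  ∈-↭∷⁻ : ∀ {x y : A} {xs ys} → x ∈ xs → xs ↭ y ∷ ys → x ≡ y ⊎ x ∈ ys
  ∈-↭∷⁻ x∈xs p = toSum (∈-resp-↭ p x∈xs)

  ∈-↭∷∷⁻ : ∀ {x y : A} {xs ys} → x ∈ xs → xs ↭ y ∷ y ∷ ys → x ∈ y ∷ ys
  ∈-↭∷∷⁻ x∈xs p with ∈-resp-↭ p x∈xs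
  ... | here x≡y     = here x≡y
  ... | there x∈y∷ys = x∈y∷ys

  swap₀ : ∀ {x y : A} {xs} → x ∷ y ∷ xs ↭ y ∷ x ∷ xs
  swap₀ {x} {y} = swap x y ↭-refl

  prep-after : ∀ (x : A) zs {xs ys} → xs ↭ zs ++ ys → x ∷ xs ↭ zs ++ x ∷ ys
  prep-after x zs p = ↭-trans (prep x p) (↭-sym (shift x zs _))

  ↭-∷-cases : ∀ {x y : A} {xs ys} → x ∷ xs ↭ y ∷ ys →
              (x ≡ y × xs ↭ ys) ⊎ (∃ λ zs → xs ↭ y ∷ zs × ys ↭ x ∷ zs)
  ↭-∷-cases {x} {y} p with ∈-resp-↭ (↭-sym p) (here refl)
  ... | here refl = inj₁ (refl , drop-∷ p)
  ... | there y∈xs with zs , q ← ∈⇒↭∷ y∈xs =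
    inj₂ (zs , q , drop-∷ (↭-trans (↭-sym p) (prep-after x [ y ] q)))

  ↭-∷∷-cases : ∀ {x y : A} {xs ys} → x ∷ xs ↭ y ∷ y ∷ ys →
               (x ≡ y × xs ↭ y ∷ ys) ⊎ (∃ λ zs → xs ↭ y ∷ y ∷ zs × ys ↭ x ∷ zs)
  ↭-∷∷-cases {y = y} p with ↭-∷-cases p
  ... | inj₁ (refl , q) = inj₁ (refl , q)
  ... | inj₂ (zs , q , r) with ↭-∷-cases r
  ...   | inj₁ (refl , s)   = inj₁ (refl , ↭-trans q (prep y (↭-sym s)))
  ...   | inj₂ (ws , s , t) = inj₂ (ws , ↭-trans q (prep y t) , s)

↭-map□++-cases : ∀ {x xs} Γ Σ → x ∷ xs ↭ map □_ Γ ++ Σ →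
  (∃ λ y → x ≡ □ y × ∃ λ Γ′ → Γ ↭ y ∷ Γ′ × xs ↭ map □_ Γ′ ++ Σ)
  ⊎ (∃ λ Σ′ → Σ ↭ x ∷ Σ′ × xs ↭ map □_ Γ ++ Σ′)
↭-map□++-cases {x} Γ Σ p with ∈-++⁻ (map □_ Γ) (∈-resp-↭ p (here refl))
... | inj₁ x∈□Γ with y , y∈Γ , refl ← ∈-map⁻ □_ x∈□Γ with Γ′ , q ← ∈⇒↭∷ y∈Γ =
  inj₁ (y , refl , Γ′ , q , drop-∷ (↭-trans p (++⁺ʳ Σ (map⁺ □_ q))))
... | inj₂ x∈Σ with Σ′ , q ← ∈⇒↭∷ x∈Σ =
  inj₂ (Σ′ , q , drop-∷ (↭-trans p (↭-trans (++⁺ˡ (map □_ Γ) q) (shift x (map □_ Γ) Σ′))))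

-- GLʰ n S : S has a derivation of height at most n (axioms live at every height), in which
-- principal formulas sit at the head and exchange is an explicit height-preserving rule.
data GLʰ : ℕ → Seq → Set where
  id₁  : ∀ {n Γ Δ} p → atom p ∈ Γ → atom p ∈ Δ → GLʰ n (Γ , Δ)
  id₂  : ∀ {n Γ Δ} φ → □ φ ∈ Γ → □ φ ∈ Δ → GLʰ n (Γ , Δ)
  ∨L   : ∀ {n Γ Δ} φ ψ → GLʰ n (φ ∷ Γ , Δ) → GLʰ n (ψ ∷ Γ , Δ) →
         GLʰ (suc n) ((φ ∨′ ψ) ∷ Γ , Δ)
  ∨R   : ∀ {n Γ Δ} φ ψ → GLʰ n (Γ , φ ∷ ψ ∷ Δ) → GLʰ (suc n) (Γ , (φ ∨′ ψ) ∷ Δ)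
  ¬L   : ∀ {n Γ Δ} φ → GLʰ n (Γ , φ ∷ Δ) → GLʰ (suc n) ((¬′ φ) ∷ Γ , Δ)
  ¬R   : ∀ {n Γ Δ} φ → GLʰ n (φ ∷ Γ , Δ) → GLʰ (suc n) (Γ , (¬′ φ) ∷ Δ)
  □GL  : ∀ {n Σ Δ} Γ φ → GLʰ n (map □_ Γ ++ Γ ++ [ □ φ ] , [ φ ]) →
         GLʰ (suc n) (map □_ Γ ++ Σ , □ φ ∷ Δ)
  exch : ∀ {n Γ Γ′ Δ Δ′} → GLʰ n (Γ , Δ) → Γ ↭ Γ′ → Δ ↭ Δ′ → GLʰ n (Γ′ , Δ′)

raise : ∀ {m n S} → m ≤ n → GLʰ m S → GLʰ n S
raise _       (id₁ p a b)  = id₁ p a b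
raise _       (id₂ φ a b)  = id₂ φ a b
raise (s≤s l) (∨L φ ψ d e) = ∨L φ ψ (raise l d) (raise l e)
raise (s≤s l) (∨R φ ψ d)   = ∨R φ ψ (raise l d)
raise (s≤s l) (¬L φ d)     = ¬L φ (raise l d)
raise (s≤s l) (¬R φ d)     = ¬R φ (raise l d)
raise (s≤s l) (□GL Γ φ d)  = □GL Γ φ (raise l d)
raise l       (exch d p q) = exch (raise l d) p q

raise₁ : ∀ {n S} → GLʰ n S → GLʰ (suc n) S
raise₁ = raise (n≤1+n _)

GL-exch : ∀ {Γ Γ′ Δ Δ′} → GL (Γ , Δ) → Γ ↭ Γ′ → Δ ↭ Δ′ → GL (Γ′ , Δ′)
GL-exch (id φ a b)        p q = id φ (∈-resp-↭ p a) (∈-resp-↭ q b)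
GL-exch (∨L φ ψ e d₁ d₂)  p q =
  ∨L φ ψ (↭-trans (↭-sym p) e) (GL-exch d₁ ↭-refl q) (GL-exch d₂ ↭-refl q)
GL-exch (∨R φ ψ e d)      p q = ∨R φ ψ (↭-trans (↭-sym q) e) (GL-exch d p ↭-refl)
GL-exch (¬L φ e d)        p q = ¬L φ (↭-trans (↭-sym p) e) (GL-exch d ↭-refl (prep φ q))
GL-exch (¬R φ e d)        p q = ¬R φ (↭-trans (↭-sym q) e) (GL-exch d (prep φ p) ↭-refl)
GL-exch (□GL Γ φ e₁ e₂ d) p q = □GL Γ φ (↭-trans (↭-sym p) e₁) (↭-trans (↭-sym q) e₂) d

GLʰ⇒GL : ∀ {n S} → GLʰ n S → GL S
GLʰ⇒GL (id₁ p a b)  = id (atom p) a b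
GLʰ⇒GL (id₂ φ a b)  = id (□ φ) a b
GLʰ⇒GL (∨L φ ψ d e) = ∨L φ ψ ↭-refl (GLʰ⇒GL d) (GLʰ⇒GL e)
GLʰ⇒GL (∨R φ ψ d)   = ∨R φ ψ ↭-refl (GLʰ⇒GL d)
GLʰ⇒GL (¬L φ d)     = ¬L φ ↭-refl (GLʰ⇒GL d)
GLʰ⇒GL (¬R φ d)     = ¬R φ ↭-refl (GLʰ⇒GL d)
GLʰ⇒GL (□GL Γ φ d)  = □GL Γ φ ↭-refl ↭-refl (GLʰ⇒GL d)
GLʰ⇒GL (exch d p q) = GL-exch (GLʰ⇒GL d) p q

¬L-inv : ∀ {n Γ Γ₀ Δ a} → GLʰ n (Γ , Δ) → Γ ↭ (¬′ a) ∷ Γ₀ → GLʰ n (Γ₀ , a ∷ Δ)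
¬L-inv (id₁ p x y) q with inj₂ x′ ← ∈-↭∷⁻ x q = id₁ p x′ (there y)
¬L-inv (id₂ φ x y) q with inj₂ x′ ← ∈-↭∷⁻ x q = id₂ φ x′ (there y)
¬L-inv (∨L φ ψ d e) q with inj₂ (_ , r₁ , r₂) ← ↭-∷-cases q =
  exch (∨L φ ψ (¬L-inv d (prep-after φ [ _ ] r₁)) (¬L-inv e (prep-after ψ [ _ ] r₁)))
       (↭-sym r₂) ↭-refl
¬L-inv (∨R φ ψ d) q =
  exch (∨R φ ψ (exch (¬L-inv d q) ↭-refl (↭-trans swap₀ (prep φ swap₀)))) ↭-refl swap₀
¬L-inv (¬L φ d) q with ↭-∷-cases q
... | inj₁ (refl , r)      = raise₁ (exch d r ↭-refl)
... | inj₂ (_ , r₁ , r₂) = exch (¬L φ (exch (¬L-inv d r₁) ↭-refl swap₀)) (↭-sym r₂) ↭-refl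
¬L-inv (¬R φ d) q = exch (¬R φ (¬L-inv d (prep-after φ [ _ ] q))) ↭-refl swap₀
¬L-inv (□GL Γ φ d) q with inj₂ (_ , _ , r) ← ↭-map□++-cases Γ _ (↭-sym q) =
  exch (□GL Γ φ d) (↭-sym r) swap₀
¬L-inv {a = a} (exch d p₁ p₂) q = exch (¬L-inv d (↭-trans p₁ q)) ↭-refl (prep a p₂)

¬R-inv : ∀ {n Γ Δ Δ₀ a} → GLʰ n (Γ , Δ) → Δ ↭ (¬′ a) ∷ Δ₀ → GLʰ n (a ∷ Γ , Δ₀)
¬R-inv (id₁ p x y) q with inj₂ y′ ← ∈-↭∷⁻ y q = id₁ p (there x) y′
¬R-inv (id₂ φ x y) q with inj₂ y′ ← ∈-↭∷⁻ y q = id₂ φ (there x) y′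
¬R-inv (∨L φ ψ d e) q =
  exch (∨L φ ψ (exch (¬R-inv d q) swap₀ ↭-refl) (exch (¬R-inv e q) swap₀ ↭-refl)) swap₀ ↭-refl
¬R-inv (∨R φ ψ d) q with inj₂ (_ , r₁ , r₂) ← ↭-∷-cases q =
  exch (∨R φ ψ (¬R-inv d (↭-trans (prep φ (prep ψ r₁)) (shifts (φ ∷ ψ ∷ []) [ _ ]))))
       ↭-refl (↭-sym r₂)
¬R-inv (¬L φ d) q = exch (¬L φ (¬R-inv d (prep-after φ [ _ ] q))) swap₀ ↭-refl
¬R-inv (¬R φ d) q with ↭-∷-cases q
... | inj₁ (refl , r)    = raise₁ (exch d ↭-refl r)
... | inj₂ (_ , r₁ , r₂) = exch (¬R φ (exch (¬R-inv d r₁) swap₀ ↭-refl)) ↭-refl (↭-sym r₂)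
¬R-inv {a = a} (□GL {Σ = Σ} Γ φ d) q with inj₂ (_ , _ , r) ← ↭-∷-cases q =
  exch (□GL {Σ = a ∷ Σ} Γ φ d) (shift a (map □_ Γ) Σ) (↭-sym r)
¬R-inv {a = a} (exch d p₁ p₂) q = exch (¬R-inv d (↭-trans p₂ q)) (prep a p₁) ↭-refl

-- The selector c ≡ a ⊎ c ≡ b states both inversions of ∨L at once.
∨L-inv : ∀ {n Γ Γ₀ Δ a b c} → c ≡ a ⊎ c ≡ b →
         GLʰ n (Γ , Δ) → Γ ↭ (a ∨′ b) ∷ Γ₀ → GLʰ n (c ∷ Γ₀ , Δ)
∨L-inv _ (id₁ p x y) q with inj₂ x′ ← ∈-↭∷⁻ x q = id₁ p (there x′) y
∨L-inv _ (id₂ φ x y) q with inj₂ x′ ← ∈-↭∷⁻ x q = id₂ φ (there x′) y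
∨L-inv c≡ (∨L φ ψ d e) q with c≡ | ↭-∷-cases q
... | inj₁ refl | inj₁ (refl , r) = raise₁ (exch d (prep φ r) ↭-refl)
... | inj₂ refl | inj₁ (refl , r) = raise₁ (exch e (prep ψ r) ↭-refl)
∨L-inv {c = c} c≡ (∨L φ ψ d e) q | _ | inj₂ (_ , r₁ , r₂) =
  exch (∨L φ ψ (exch (∨L-inv c≡ d (prep-after φ [ _ ] r₁)) swap₀ ↭-refl)
               (exch (∨L-inv c≡ e (prep-after ψ [ _ ] r₁)) swap₀ ↭-refl))
       (↭-trans swap₀ (prep c (↭-sym r₂))) ↭-refl
∨L-inv c≡ (∨R φ ψ d) q = ∨R φ ψ (∨L-inv c≡ d q)
∨L-inv {c = c} c≡ (¬L φ d) q with inj₂ (_ , r₁ , r₂) ← ↭-∷-cases q =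
  exch (¬L φ (∨L-inv c≡ d r₁)) (↭-trans swap₀ (prep c (↭-sym r₂))) ↭-refl
∨L-inv c≡ (¬R φ d) q = ¬R φ (exch (∨L-inv c≡ d (prep-after φ [ _ ] q)) swap₀ ↭-refl)
∨L-inv {c = c} c≡ (□GL Γ φ d) q with inj₂ (Σ′ , _ , r) ← ↭-map□++-cases Γ _ (↭-sym q) =
  exch (□GL {Σ = c ∷ Σ′} Γ φ d) (↭-sym (prep-after c (map □_ Γ) r)) ↭-refl
∨L-inv c≡ (exch d p₁ p₂) q = exch (∨L-inv c≡ d (↭-trans p₁ q)) ↭-refl p₂

∨R-inv : ∀ {n Γ Δ Δ₀ a b} → GLʰ n (Γ , Δ) → Δ ↭ (a ∨′ b) ∷ Δ₀ → GLʰ n (Γ , a ∷ b ∷ Δ₀)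
∨R-inv (id₁ p x y) q with inj₂ y′ ← ∈-↭∷⁻ y q = id₁ p x (there (there y′))
∨R-inv (id₂ φ x y) q with inj₂ y′ ← ∈-↭∷⁻ y q = id₂ φ x (there (there y′))
∨R-inv (∨L φ ψ d e) q = ∨L φ ψ (∨R-inv d q) (∨R-inv e q)
∨R-inv {a = a} {b} (∨R φ ψ d) q with ↭-∷-cases q
... | inj₁ (refl , r) = raise₁ (exch d ↭-refl (prep a (prep b r)))
... | inj₂ (_ , r₁ , r₂) =
  exch (∨R φ ψ (exch (∨R-inv d (↭-trans (prep φ (prep ψ r₁)) (shifts (φ ∷ ψ ∷ []) [ _ ])))
                     ↭-refl (shifts (a ∷ b ∷ []) (φ ∷ ψ ∷ []))))
       ↭-refl (↭-trans (shifts [ _ ] (a ∷ b ∷ [])) (prep a (prep b (↭-sym r₂))))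
∨R-inv (¬L φ d) q =
  ¬L φ (exch (∨R-inv d (prep-after φ [ _ ] q)) ↭-refl (shifts (_ ∷ _ ∷ []) [ φ ]))
∨R-inv {a = a} {b} (¬R φ d) q with inj₂ (_ , r₁ , r₂) ← ↭-∷-cases q =
  exch (¬R φ (∨R-inv d r₁)) ↭-refl
       (↭-trans (shifts [ _ ] (a ∷ b ∷ [])) (prep a (prep b (↭-sym r₂))))
∨R-inv {a = a} {b} (□GL Γ φ d) q with inj₂ (_ , _ , r) ← ↭-∷-cases q =
  exch (□GL Γ φ d) ↭-refl (↭-trans (shifts [ _ ] (a ∷ b ∷ [])) (prep a (prep b (↭-sym r))))
∨R-inv (exch d p₁ p₂) q = exch (∨R-inv d (↭-trans p₂ q)) p₁ ↭-refl

Contractionˡ : Fm → Set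
Contractionˡ A = ∀ {n Γ Γ₀ Δ} → GLʰ n (Γ , Δ) → Γ ↭ A ∷ A ∷ Γ₀ → GLʰ n (A ∷ Γ₀ , Δ)

Contractionʳ : Fm → Set
Contractionʳ A = ∀ {n Γ Δ Δ₀} → GLʰ n (Γ , Δ) → Δ ↭ A ∷ A ∷ Δ₀ → GLʰ n (Γ , A ∷ Δ₀)

Contractible : Fm → Set
Contractible A = Contractionˡ A × Contractionʳ A

ImmediateSubformulasContractible : Fm → Set
ImmediateSubformulasContractible (atom p) = ⊤
ImmediateSubformulasContractible (¬′ φ)   = Contractible φ
ImmediateSubformulasContractible (φ ∨′ ψ) = Contractible φ × Contractible ψ
ImmediateSubformulasContractible (□ φ)    = Contractible φ

module Contraction (A : Fm) (ih : ImmediateSubformulasContractible A) where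

  contractˡ : Contractionˡ A
  contractˡ (id₁ p x y) q = id₁ p (∈-↭∷∷⁻ x q) y
  contractˡ (id₂ φ x y) q = id₂ φ (∈-↭∷∷⁻ x q) y
  contractˡ (∨L φ ψ d e) q with ↭-∷∷-cases q
  ... | inj₁ (refl , r) =
    let (contractˡ-φ , _) , (contractˡ-ψ , _) = ih in
    ∨L φ ψ (contractˡ-φ (∨L-inv (inj₁ refl) d (prep-after φ [ _ ] r)) ↭-refl)
           (contractˡ-ψ (∨L-inv (inj₂ refl) e (prep-after ψ [ _ ] r)) ↭-refl)
  ... | inj₂ (_ , r₁ , r₂) =
    exch (∨L φ ψ (exch (contractˡ d (prep-after φ (_ ∷ _ ∷ []) r₁)) swap₀ ↭-refl)
                 (exch (contractˡ e (prep-after ψ (_ ∷ _ ∷ []) r₁)) swap₀ ↭-refl))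
         (↭-trans swap₀ (prep A (↭-sym r₂))) ↭-refl
  contractˡ (∨R φ ψ d) q = ∨R φ ψ (contractˡ d q)
  contractˡ (¬L φ d) q with ↭-∷∷-cases q
  ... | inj₁ (refl , r)    = ¬L φ (proj₂ ih (¬L-inv d r) ↭-refl)
  ... | inj₂ (_ , r₁ , r₂) =
    exch (¬L φ (contractˡ d r₁)) (↭-trans swap₀ (prep A (↭-sym r₂))) ↭-refl
  contractˡ (¬R φ d) q = ¬R φ (exch (contractˡ d (prep-after φ (_ ∷ _ ∷ []) q)) swap₀ ↭-refl)
  contractˡ (□GL {m} {Σ} Γ φ d) q with ↭-map□++-cases Γ Σ (↭-sym q)
  ... | inj₂ (Σ′ , _ , r) = exch (□GL {Σ = Σ′} Γ φ d) (↭-sym r) ↭-refl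
  ... | inj₁ (y , refl , Γ′ , s , r) with ↭-map□++-cases Γ′ Σ r
  ...   | inj₂ (Σ′ , _ , r′) =
    exch (□GL {Σ = Σ′} Γ φ d) (↭-trans (++⁺ʳ Σ′ (map⁺ □_ s)) (prep (□ y) (↭-sym r′))) ↭-refl
  ...   | inj₁ (_ , refl , Γ″ , s′ , r′) =
    exch (□GL (y ∷ Γ″) φ d′) (prep (□ y) (↭-sym r′)) ↭-refl
    where
      -- Both copies of □y lie in the boxed context, so the premise holds □y and y twice each:
      -- contract □y in the smaller derivation d, and y by the induction hypothesis.
      X R : List Fm
      X = [ □ φ ]
      R = map □_ Γ″ ++ Γ″ ++ X
      Γ↭ : Γ ↭ y ∷ y ∷ Γ″
      Γ↭ = ↭-trans s (prep y s′)
      premise↭ : map □_ Γ ++ Γ ++ X ↭ □ y ∷ □ y ∷ y ∷ y ∷ R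
      premise↭ = ↭-trans (++⁺ (map⁺ □_ Γ↭) (++⁺ʳ X Γ↭))
                         (prep (□ y) (prep (□ y) (shifts (map □_ Γ″) (y ∷ y ∷ []))))
      regroup : y ∷ □ y ∷ R ↭ map □_ (y ∷ Γ″) ++ (y ∷ Γ″) ++ X
      regroup = ↭-trans swap₀ (prep (□ y) (↭-sym (shift y (map □_ Γ″) (Γ″ ++ X))))
      d′ : GLʰ m (map □_ (y ∷ Γ″) ++ (y ∷ Γ″) ++ X , [ φ ])
      d′ = exch (proj₁ ih (contractˡ d premise↭) (shifts [ □ y ] (y ∷ y ∷ []))) regroup ↭-refl
  contractˡ (exch d p₁ p₂) q = exch (contractˡ d (↭-trans p₁ q)) ↭-refl p₂

  contractʳ : Contractionʳ A
  contractʳ (id₁ p x y) q = id₁ p x (∈-↭∷∷⁻ y q)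
  contractʳ (id₂ φ x y) q = id₂ φ x (∈-↭∷∷⁻ y q)
  contractʳ (∨L φ ψ d e) q = ∨L φ ψ (contractʳ d q) (contractʳ e q)
  contractʳ {Δ₀ = Δ₀} (∨R {Δ = Δ′} φ ψ d) q with ↭-∷∷-cases q
  ... | inj₁ (refl , r) =
    let (_ , contractʳ-φ) , (_ , contractʳ-ψ) = ih in
    ∨R φ ψ (exch (contractʳ-ψ (contractʳ-φ (∨R-inv d Δ↭) (prep φ swap₀))
                              (shifts [ φ ] (ψ ∷ ψ ∷ [])))
                 ↭-refl swap₀)
    where Δ↭ : φ ∷ ψ ∷ Δ′ ↭ (φ ∨′ ψ) ∷ φ ∷ ψ ∷ Δ₀
          Δ↭ = ↭-trans (prep φ (prep ψ r)) (shifts (φ ∷ ψ ∷ []) [ _ ])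
  ... | inj₂ (_ , r₁ , r₂) =
    exch (∨R φ ψ (exch (contractʳ d (↭-trans (prep φ (prep ψ r₁))
                                             (shifts (φ ∷ ψ ∷ []) (A ∷ A ∷ []))))
                       ↭-refl (shifts [ A ] (φ ∷ ψ ∷ []))))
         ↭-refl (↭-trans swap₀ (prep A (↭-sym r₂)))
  contractʳ (¬L φ d) q = ¬L φ (exch (contractʳ d (prep-after φ (_ ∷ _ ∷ []) q)) ↭-refl swap₀)
  contractʳ (¬R φ d) q with ↭-∷∷-cases q
  ... | inj₁ (refl , r)    = ¬R φ (proj₁ ih (¬R-inv d r) ↭-refl)
  ... | inj₂ (_ , r₁ , r₂) =
    exch (¬R φ (contractʳ d r₁)) ↭-refl (↭-trans swap₀ (prep A (↭-sym r₂)))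
  contractʳ (□GL Γ φ d) q with Δ , r ← ∈⇒↭∷ (∈-↭∷∷⁻ (here refl) q) =
    exch (□GL {Δ = Δ} Γ φ d) ↭-refl (↭-sym r)
  contractʳ (exch d p₁ p₂) q = exch (contractʳ d (↭-trans p₂ q)) p₁ ↭-refl

mutual
  contractible : ∀ A → Contractible A
  contractible A = contractˡ , contractʳ
    where open Contraction A (immediateSubformulasContractible A)

  immediateSubformulasContractible : ∀ A → ImmediateSubformulasContractible A
  immediateSubformulasContractible (atom p) = tt
  immediateSubformulasContractible (¬′ φ)   = contractible φ
  immediateSubformulasContractible (φ ∨′ ψ) = contractible φ , contractible ψ
  immediateSubformulasContractible (□ φ)    = contractible φ

contract-∈ˡ : ∀ {n A Γ Δ} → A ∈ Γ → GLʰ n (A ∷ Γ , Δ) → GLʰ n (Γ , Δ)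
contract-∈ˡ {A = A} A∈Γ d with Γ₀ , r ← ∈⇒↭∷ A∈Γ =
  exch (proj₁ (contractible A) d (prep A r)) (↭-sym r) ↭-refl

contract-∈ʳ : ∀ {n A Γ Δ} → A ∈ Δ → GLʰ n (Γ , A ∷ Δ) → GLʰ n (Γ , Δ)
contract-∈ʳ {A = A} A∈Δ d with Δ₀ , r ← ∈⇒↭∷ A∈Δ =
  exch (proj₂ (contractible A) d (prep A r)) ↭-refl (↭-sym r)

boxed : List Fm → List Fm
boxed []             = []
boxed (atom p ∷ Γ)   = boxed Γ
boxed ((¬′ φ) ∷ Γ)   = boxed Γ
boxed ((φ ∨′ ψ) ∷ Γ) = boxed Γ
boxed ((□ φ) ∷ Γ)    = φ ∷ boxed Γ

↭-map□-boxed++ : ∀ Γ → ∃ λ Σ → Γ ↭ map □_ (boxed Γ) ++ Σ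
↭-map□-boxed++ [] = [] , ↭-refl
↭-map□-boxed++ (atom p ∷ Γ) with Σ , Γ↭ ← ↭-map□-boxed++ Γ =
  atom p ∷ Σ , prep-after (atom p) _ Γ↭
↭-map□-boxed++ ((¬′ φ) ∷ Γ) with Σ , Γ↭ ← ↭-map□-boxed++ Γ =
  (¬′ φ) ∷ Σ , prep-after (¬′ φ) _ Γ↭
↭-map□-boxed++ ((φ ∨′ ψ) ∷ Γ) with Σ , Γ↭ ← ↭-map□-boxed++ Γ =
  (φ ∨′ ψ) ∷ Σ , prep-after (φ ∨′ ψ) _ Γ↭
↭-map□-boxed++ ((□ φ) ∷ Γ) with Σ , Γ↭ ← ↭-map□-boxed++ Γ =
  Σ , prep (□ φ) Γ↭

∈-boxed : ∀ {φ Γ} → □ φ ∈ Γ → φ ∈ boxed Γ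
∈-boxed {Γ = atom _ ∷ _}   (there m)   = ∈-boxed m
∈-boxed {Γ = (¬′ _) ∷ _}   (there m)   = ∈-boxed m
∈-boxed {Γ = (_ ∨′ _) ∷ _} (there m)   = ∈-boxed m
∈-boxed {Γ = (□ _) ∷ _}    (here refl) = here refl
∈-boxed {Γ = (□ _) ∷ _}    (there m)   = there (∈-boxed m)

Derivableʰ : Seq → Set
Derivableʰ S = ∃ λ n → GLʰ n S

∨L-⊔ : ∀ {Γ Δ} φ ψ → Derivableʰ (φ ∷ Γ , Δ) → Derivableʰ (ψ ∷ Γ , Δ) →
       Derivableʰ ((φ ∨′ ψ) ∷ Γ , Δ)
∨L-⊔ φ ψ (n₁ , d₁) (n₂ , d₂) =
  suc (n₁ ⊔ n₂) , ∨L φ ψ (raise (m≤m⊔n n₁ n₂) d₁) (raise (m≤n⊔m n₁ n₂) d₂)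

□GL-boxed : ∀ {n Γ Δ φ} → □ φ ∈ Δ → GLʰ n (map □_ (boxed Γ) ++ boxed Γ ++ [ □ φ ] , [ φ ]) →
            GLʰ (suc n) (Γ , Δ)
□GL-boxed {Γ = Γ} {φ = φ} □φ∈Δ d with Σ , Γ↭ ← ↭-map□-boxed++ Γ | Δ₀ , Δ↭ ← ∈⇒↭∷ □φ∈Δ =
  exch (□GL (boxed Γ) φ d) (↭-sym Γ↭) (↭-sym Δ↭)

-- Quantified over all decompositions of H, since _∷ʳ_ cannot be matched on.
LastBoxesIn : List Seq → List Fm → Set
LastBoxesIn H T = ∀ G Γ Δ → H ≡ G ∷ʳ (Γ , Δ) → ∀ {ψ} → □ ψ ∈ Γ → □ ψ ∈ T × ψ ∈ T

lastBoxesIn-boxed : ∀ {G Γ Δ Γ⁺} X → Γ ⊆ Γ⁺ →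
                    LastBoxesIn (G ∷ʳ (Γ , Δ)) (map □_ (boxed Γ⁺) ++ boxed Γ⁺ ++ X)
lastBoxesIn-boxed {G} {Γ⁺ = Γ⁺} X Γ⊆ G₁ Γ₁ Δ₁ eq □ψ∈Γ with refl ← ∷ʳ-injectiveʳ G G₁ eq
  with ψ∈boxed ← ∈-boxed (Γ⊆ □ψ∈Γ) =
  ∈-++⁺ˡ (∈-map⁺ □_ ψ∈boxed) , ∈-++⁺ʳ (map □_ (boxed Γ⁺)) (∈-++⁺ˡ ψ∈boxed)

mutual
  localBlock⇒GLʰ : ∀ {G Γ Δ} {d : LN (G , Γ , Δ)} → LocalBlock d →
                   ∀ {Γ⁺ Δ⁺} → Γ ⊆ Γ⁺ → Δ ⊆ Δ⁺ → Derivableʰ (Γ⁺ , Δ⁺)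
  localBlock⇒GLʰ (lb-leaf l) Γ⊆ Δ⊆ = leaf⇒GLʰ l Γ⊆ Δ⊆
  localBlock⇒GLʰ (lb-∨L {Γ′ = Γ₀} {φ = φ} {ψ} {e} b₁ b₂) {Γ⁺} Γ⊆ Δ⊆ =
    map₂ (contract-∈ˡ (Γ⊆′ (here refl)))
         (∨L-⊔ φ ψ (localBlock⇒GLʰ b₁ (∷⁺ʳ φ (λ m → Γ⊆′ (there m))) Δ⊆)
                   (localBlock⇒GLʰ b₂ (∷⁺ʳ ψ (λ m → Γ⊆′ (there m))) Δ⊆))
    where Γ⊆′ : (φ ∨′ ψ) ∷ Γ₀ ⊆ Γ⁺
          Γ⊆′ = ⊆-respˡ-↭ e Γ⊆
  localBlock⇒GLʰ (lb-∨R {Δ′ = Δ₀} {φ} {ψ} {e} b) {Δ⁺ = Δ⁺} Γ⊆ Δ⊆ =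
    Product.map suc (λ d → contract-∈ʳ (Δ⊆′ (here refl)) (∨R φ ψ d))
                (localBlock⇒GLʰ b Γ⊆ (∷⁺ʳ φ (∷⁺ʳ ψ (λ m → Δ⊆′ (there m)))))
    where Δ⊆′ : (φ ∨′ ψ) ∷ Δ₀ ⊆ Δ⁺
          Δ⊆′ = ⊆-respˡ-↭ e Δ⊆
  localBlock⇒GLʰ (lb-¬L {Γ′ = Γ₀} {φ = φ} {e} b) {Γ⁺} Γ⊆ Δ⊆ =
    Product.map suc (λ d → contract-∈ˡ (Γ⊆′ (here refl)) (¬L φ d))
                (localBlock⇒GLʰ b (λ m → Γ⊆′ (there m)) (∷⁺ʳ φ Δ⊆))
    where Γ⊆′ : (¬′ φ) ∷ Γ₀ ⊆ Γ⁺
          Γ⊆′ = ⊆-respˡ-↭ e Γ⊆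
  localBlock⇒GLʰ (lb-¬R {Δ′ = Δ₀} {φ} {e} b) {Δ⁺ = Δ⁺} Γ⊆ Δ⊆ =
    Product.map suc (λ d → contract-∈ʳ (Δ⊆′ (here refl)) (¬R φ d))
                (localBlock⇒GLʰ b (∷⁺ʳ φ Γ⊆) (λ m → Δ⊆′ (there m)))
    where Δ⊆′ : (¬′ φ) ∷ Δ₀ ⊆ Δ⁺
          Δ⊆′ = ⊆-respˡ-↭ e Δ⊆

  leaf⇒GLʰ : ∀ {G Γ Δ} {d : LN (G , Γ , Δ)} → Leaf d →
             ∀ {Γ⁺ Δ⁺} → Γ ⊆ Γ⁺ → Δ ⊆ Δ⁺ → Derivableʰ (Γ⁺ , Δ⁺)
  leaf⇒GLʰ (leaf-id₁ {p = p} {a} {b}) Γ⊆ Δ⊆ = 0 , id₁ p (Γ⊆ a) (Δ⊆ b)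
  leaf⇒GLʰ (leaf-id₂ {φ = φ} {a} {b}) Γ⊆ Δ⊆ = 0 , id₂ φ (Γ⊆ a) (Δ⊆ b)
  leaf⇒GLʰ (leaf-□R {φ = φ} {e} b) {Γ⁺} Γ⊆ Δ⊆ =
    Product.map suc (□GL-boxed (⊆-respˡ-↭ e Δ⊆ (here refl)))
                (fourBlock⇒GLʰ b (lastBoxesIn-boxed [ □ φ ] Γ⊆) □φ⊆ ⊆-refl)
    where □φ⊆ : [ □ φ ] ⊆ map □_ (boxed Γ⁺) ++ boxed Γ⁺ ++ [ □ φ ]
          □φ⊆ (here refl) = ∈-++⁺ʳ (map □_ (boxed Γ⁺)) (∈-++⁺ʳ (boxed Γ⁺) (here refl))

  fourBlock⇒GLʰ : ∀ {H Σ Π} {d : LN (H , Σ , Π)} → FourBlock d →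
                  ∀ {T Π⁺} → LastBoxesIn H T → Σ ⊆ T → Π ⊆ Π⁺ → Derivableʰ (T , Π⁺)
  fourBlock⇒GLʰ (fb-end b) boxes Σ⊆ Π⊆ = boxLBlock⇒GLʰ b boxes Σ⊆ Π⊆
  fourBlock⇒GLʰ (fb-4L {G = G} {Γ} {Δ} {m = □φ∈Γ} b) boxes Σ⊆ Π⊆ =
    fourBlock⇒GLʰ b boxes (∈-∷⁺ʳ (proj₁ (boxes G Γ Δ refl □φ∈Γ)) Σ⊆) Π⊆

  boxLBlock⇒GLʰ : ∀ {H Σ Π} {d : LN (H , Σ , Π)} → BoxLBlock d →
                  ∀ {T Π⁺} → LastBoxesIn H T → Σ ⊆ T → Π ⊆ Π⁺ → Derivableʰ (T , Π⁺)
  boxLBlock⇒GLʰ (bl-end b) _ Σ⊆ Π⊆ = localBlock⇒GLʰ b Σ⊆ Π⊆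
  boxLBlock⇒GLʰ (bl-□L {G = G} {Γ} {Δ} {m = □φ∈Γ} b) boxes Σ⊆ Π⊆ =
    boxLBlock⇒GLʰ b boxes (∈-∷⁺ʳ (proj₂ (boxes G Γ Δ refl □φ∈Γ)) Σ⊆) Π⊆

theorem5p2 : (φ : Fm) (π : LN ([] , [] , [ φ ])) → NormalForm π → GL ([] , [ φ ])
theorem5p2 _ _ nf = GLʰ⇒GL (proj₂ (localBlock⇒GLʰ nf (λ ()) ⊆-refl))
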